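{- Let $r$ and $t$ be introductions (each an abstraction or a product), and $s,u$ terms. If $rs\rightleftarrows^* tu$, then $r\rightleftarrows^* t$ and $s\rightleftarrows^* u$.
   Context: Preterms are $r ::= x \mid \lambda x.r \mid rr \mid r\times r \mid \pi_A(r)$ (application left associative), where $A$ ranges over types generated by $A::=\tau\mid A\Rightarrow A\mid A\wedge A$ and variables are drawn from sets $\mathcal V_A$ indexed by types; one writes $\lambda x^A.r$ for $\lambda x.r$ when $x\in\mathcal V_A$. Terms are the well-typed preterms. Introductions are abstractions and products; eliminations are applications and projections. The relation $\rightleftarrows$ is the smallest symmetric relation on terms, closed under all term contexts, containing: $r\times s\rightleftarrows s\times r$; $(r\times s)\times t\rightleftarrows r\times(s\times t)$; $\lambda x^A.(r\times s)\rightleftarrows \lambda x^A.r\times\lambda x^A.s$; $rst\rightleftarrows r(s\times t)$. $\rightleftarrows^*$ is its reflexive transitive closure. -}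

module Defs where

open import Data.Nat using (ℕ)
open import Data.Product using (∃; _×_)
open import Relation.Binary.Construct.Closure.ReflexiveTransitive using (Star)

infixr 7 _⇒_
infixr 8 _∧_

data Type : Set where
  τ   : Type
  _⇒_ : Type → Type → Type
  _∧_ : Type → Type → Type

infix 4 _≡ᵀ_
data _≡ᵀ_ : Type → Type → Set where
  comm   : ∀ {A B} → A ∧ B ≡ᵀ B ∧ A
  assoc  : ∀ {A B C} → (A ∧ B) ∧ C ≡ᵀ A ∧ (B ∧ C)
  dist   : ∀ {A B C} → A ⇒ (B ∧ C) ≡ᵀ (A ⇒ B) ∧ (A ⇒ C)
  curry  : ∀ {A B C} → (A ∧ B) ⇒ C ≡ᵀ A ⇒ (B ⇒ C)
  refl   : ∀ {A} → A ≡ᵀ A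
  sym    : ∀ {A B} → A ≡ᵀ B → B ≡ᵀ A
  trans  : ∀ {A B C} → A ≡ᵀ B → B ≡ᵀ C → A ≡ᵀ C
  cong⇒  : ∀ {A A' B B'} → A ≡ᵀ A' → B ≡ᵀ B' → A ⇒ B ≡ᵀ A' ⇒ B'
  cong∧  : ∀ {A A' B B'} → A ≡ᵀ A' → B ≡ᵀ B' → A ∧ B ≡ᵀ A' ∧ B'

-- Preterms. A variable of V_A is represented as  var A n  (n-th variable of type A);
-- lam A n r  is  λx^A.r  with x the n-th variable of V_A.
data Term : Set where
  var  : Type → ℕ → Term
  lam  : Type → ℕ → Term → Term
  app  : Term → Term → Term
  _×ₜ_ : Term → Term → Term
  proj : Type → Term → Term

-- Typing (variables carry their type, so no context is needed)
infix 3 ⊢_∶_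
data ⊢_∶_ : Term → Type → Set where
  ax   : ∀ {A n} → ⊢ var A n ∶ A
  conv : ∀ {r A B} → ⊢ r ∶ A → A ≡ᵀ B → ⊢ r ∶ B
  ⇒i   : ∀ {A B n r} → ⊢ r ∶ B → ⊢ lam A n r ∶ A ⇒ B
  ⇒e   : ∀ {A B r s} → ⊢ r ∶ A ⇒ B → ⊢ s ∶ A → ⊢ app r s ∶ B
  ∧i   : ∀ {A B r s} → ⊢ r ∶ A → ⊢ s ∶ B → ⊢ r ×ₜ s ∶ A ∧ B
  ∧e   : ∀ {A B r} → ⊢ r ∶ A ∧ B → ⊢ proj A r ∶ A

-- Terms = well-typed preterms
WellTyped : Term → Set
WellTyped r = ∃ λ A → ⊢ r ∶ A

data Intro : Term → Set where
  introλ : ∀ {A n r} → Intro (lam A n r)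
  intro× : ∀ {r s} → Intro (r ×ₜ s)

data _↦_ : Term → Term → Set where
  comm  : ∀ {r s} → (r ×ₜ s) ↦ (s ×ₜ r)
  assoc : ∀ {r s t} → ((r ×ₜ s) ×ₜ t) ↦ (r ×ₜ (s ×ₜ t))
  distλ : ∀ {A n r s} → lam A n (r ×ₜ s) ↦ (lam A n r ×ₜ lam A n s)
  curry : ∀ {r s t} → app (app r s) t ↦ app r (s ×ₜ t)

data _⇄ₚ_ : Term → Term → Set where
  step    : ∀ {r s} → r ↦ s → r ⇄ₚ s
  stepSym : ∀ {r s} → s ↦ r → r ⇄ₚ s
  ctxλ    : ∀ {A n r s} → r ⇄ₚ s → lam A n r ⇄ₚ lam A n s
  ctxAppˡ : ∀ {r s t} → r ⇄ₚ s → app r t ⇄ₚ app s t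
  ctxAppʳ : ∀ {r s t} → r ⇄ₚ s → app t r ⇄ₚ app t s
  ctx×ˡ   : ∀ {r s t} → r ⇄ₚ s → (r ×ₜ t) ⇄ₚ (s ×ₜ t)
  ctx×ʳ   : ∀ {r s t} → r ⇄ₚ s → (t ×ₜ r) ⇄ₚ (t ×ₜ s)
  ctxπ    : ∀ {A r s} → r ⇄ₚ s → proj A r ⇄ₚ proj A s

_⇄_ : Term → Term → Set
r ⇄ s = WellTyped r × WellTyped s × r ⇄ₚ s

_⇄*_ : Term → Term → Set
_⇄*_ = Star _⇄_

module Submission where

-- Every application  T = h a₁ a₂ … aₙ  whose head h is not an
-- application is described by its head h and its *argument*, the
-- left-nested product  a₁ × a₂ × … × aₙ  (the predicate  Spine T h a).
-- Each single ⇄-step on T can be followed by the decomposition: the new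
-- term again has a spine decomposition whose head and argument are
-- ⇄*-related to the old ones.  Currying steps  x y z ⇄ x (y × z)  merely
-- regroup the argument product by associativity, steps inside the head
-- or inside an argument are steps on the head or inside the argument
-- product, and a step never turns a non-application head into an
-- application.  Iterating along  r s ⇄* t u  (where r, t are
-- introductions, hence not applications) yields a decomposition of  t u
-- with head h' and argument a' such that r ⇄* h' and s ⇄* a'; since t is
-- not an application, the only decomposition of  t u  is h' = t, a' = u.

open import Defs
open import Data.Product using (_×_; _,_; proj₁; proj₂)
open import Relation.Binary.PropositionalEquality using (_≡_; refl)
open import Relation.Binary.Construct.Closure.ReflexiveTransitive
  using (ε; _◅_; _◅◅_; gmap)

data NotApp : Term → Set where
  nvar  : ∀ {A n} → NotApp (var A n)
  nlam  : ∀ {A n r} → NotApp (lam A n r)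
  nprod : ∀ {r s} → NotApp (r ×ₜ s)
  nproj : ∀ {A r} → NotApp (proj A r)

intro⇒notApp : ∀ {r} → Intro r → NotApp r
intro⇒notApp introλ = nlam
intro⇒notApp intro× = nprod

-- A single step never produces an application from a non-application:
-- no rule has an application on exactly one side except currying, whose
-- both sides are applications.
notApp-⇄ₚ : ∀ {a b} → NotApp a → a ⇄ₚ b → NotApp b
notApp-⇄ₚ nvar  (step ())
notApp-⇄ₚ nvar  (stepSym ())
notApp-⇄ₚ nlam  (step distλ)    = nprod
notApp-⇄ₚ nlam  (ctxλ _)        = nlam
notApp-⇄ₚ nprod (step comm)     = nprod
notApp-⇄ₚ nprod (step assoc)    = nprod
notApp-⇄ₚ nprod (stepSym comm)  = nprod
notApp-⇄ₚ nprod (stepSym assoc) = nprod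
notApp-⇄ₚ nprod (stepSym distλ) = nlam
notApp-⇄ₚ nprod (ctx×ˡ _)       = nprod
notApp-⇄ₚ nprod (ctx×ʳ _)       = nprod
notApp-⇄ₚ nproj (ctxπ _)        = nproj

-- Spine T h a :  T = h a₁ … aₙ  (n ≥ 1) with h not an application and
-- a = (…(a₁ × a₂) × …) × aₙ.
data Spine : Term → Term → Term → Set where
  base : ∀ {h a} → NotApp h → Spine (app h a) h a
  cons : ∀ {T h a c} → Spine T h a → Spine (app T c) h (a ×ₜ c)

spine-unique : ∀ {t u h a} → NotApp t → Spine (app t u) h a → (h ≡ t) × (a ≡ u)
spine-unique _  (base _)        = refl , refl
spine-unique () (cons (base _))
spine-unique () (cons (cons _))

wellTyped-app : ∀ {a b} → WellTyped (app a b) → WellTyped a × WellTyped b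
wellTyped-app (_ , d) = inv d
  where
  inv : ∀ {a b B} → ⊢ app a b ∶ B → WellTyped a × WellTyped b
  inv (conv d _) = inv d
  inv (⇒e d e)   = (_ , d) , (_ , e)

wellTyped-× : ∀ {a b} → WellTyped a → WellTyped b → WellTyped (a ×ₜ b)
wellTyped-× (_ , d) (_ , e) = _ , ∧i d e

wellTyped-spine : ∀ {T h a} → Spine T h a → WellTyped T → WellTyped h × WellTyped a
wellTyped-spine (base _)  w = wellTyped-app w
wellTyped-spine (cons sp) w =
  let wT , wc = wellTyped-app w
      wh , wa = wellTyped-spine sp wT
  in  wh , wellTyped-× wa wc

single : ∀ {x y} → WellTyped x → WellTyped y → x ⇄ₚ y → x ⇄* y
single wx wy p = (wx , wy , p) ◅ ε

×ˡ-cong* : ∀ {x y c} → WellTyped c → x ⇄* y → (x ×ₜ c) ⇄* (y ×ₜ c)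
×ˡ-cong* wc = gmap (λ x → x ×ₜ _)
  (λ (wx , wy , p) → wellTyped-× wx wc , wellTyped-× wy wc , ctx×ˡ p)

record Tracked (T h a : Term) : Set where
  constructor tracked
  field
    {head′ arg′} : Term
    spine        : Spine T head′ arg′
    head*        : h ⇄* head′
    arg*         : a ⇄* arg′

-- Currying  T c d ⇄ T (c × d)  reassociates the argument product; when T is
-- the head itself the argument is unchanged.
spine-curry : ∀ {T h a c d} → Spine (app (app T c) d) h a →
              WellTyped (app (app T c) d) → Tracked (app T (c ×ₜ d)) h a
spine-curry (cons (base nh)) _ = tracked (base nh) ε ε
spine-curry (cons (cons sp)) w =
  let wTc , wd = wellTyped-app w
      wT  , wc = wellTyped-app wTc
      _   , wa = wellTyped-spine sp wT
  in  tracked (cons sp) ε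
        (single (wellTyped-× (wellTyped-× wa wc) wd)
                (wellTyped-× wa (wellTyped-× wc wd)) (step assoc))

spine-uncurry : ∀ {T h a c d} → Spine (app T (c ×ₜ d)) h a →
                WellTyped (app (app T c) d) → Tracked (app (app T c) d) h a
spine-uncurry (base nh) _ = tracked (cons (base nh)) ε ε
spine-uncurry (cons sp) w =
  let wTc , wd = wellTyped-app w
      wT  , wc = wellTyped-app wTc
      _   , wa = wellTyped-spine sp wT
  in  tracked (cons (cons sp)) ε
        (single (wellTyped-× wa (wellTyped-× wc wd))
                (wellTyped-× (wellTyped-× wa wc) wd) (stepSym assoc))

-- Currying steps regroup the argument, a step inside
-- the last argument c is a step inside the argument product, and a step
-- inside the function part is a step on the head or (recursively) one
-- inside the spine of the function part.
spine-step : ∀ {T T′ h a} → Spine T h a → WellTyped T → WellTyped T′ →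
             T ⇄ₚ T′ → Tracked T′ h a
spine-step sp        w w′ (step curry)    = spine-curry sp w
spine-step sp        w w′ (stepSym curry) = spine-uncurry sp w′
spine-step (base nh) w w′ (ctxAppˡ p)     =
  tracked (base (notApp-⇄ₚ nh p))
          (single (proj₁ (wellTyped-app w)) (proj₁ (wellTyped-app w′)) p) ε
spine-step (cons sp) w w′ (ctxAppˡ p)     =
  let tracked sp′ h* a* = spine-step sp (proj₁ (wellTyped-app w))
                                        (proj₁ (wellTyped-app w′)) p
  in  tracked (cons sp′) h* (×ˡ-cong* (proj₂ (wellTyped-app w)) a*)
spine-step (base nh) w w′ (ctxAppʳ p)     =
  tracked (base nh) ε
          (single (proj₂ (wellTyped-app w)) (proj₂ (wellTyped-app w′)) p)
spine-step (cons sp) w w′ (ctxAppʳ p)     =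
  let _ , wa = wellTyped-spine sp (proj₁ (wellTyped-app w))
  in  tracked (cons sp) ε
        (single (wellTyped-× wa (proj₂ (wellTyped-app w)))
                (wellTyped-× wa (proj₂ (wellTyped-app w′))) (ctx×ʳ p))

spine-⇄* : ∀ {T T′ h a} → Spine T h a → T ⇄* T′ → Tracked T′ h a
spine-⇄* sp ε                  = tracked sp ε ε
spine-⇄* sp ((w , w′ , p) ◅ ps) =
  let tracked sp₁ h₁ a₁ = spine-step sp w w′ p
      tracked sp₂ h₂ a₂ = spine-⇄* sp₁ ps
  in  tracked sp₂ (h₁ ◅◅ h₂) (a₁ ◅◅ a₂)

mainTheorem14 : ∀ {r s t u} → Intro r → Intro t →
                WellTyped (app r s) → WellTyped (app t u) →
                app r s ⇄* app t u → (r ⇄* t) × (s ⇄* u)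
mainTheorem14 ir it _ _ rs⇄*tu
  with tracked sp r* s* ← spine-⇄* (base (intro⇒notApp ir)) rs⇄*tu
  with refl , refl ← spine-unique (intro⇒notApp it) sp
  = r* , s*
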